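{- Let $n\ge 2$ be an integer and let ${\mathcal T}_n$ be the closed triangle with vertices $(0,0)$, $(0,n)$, $(n/2,n/2)$. Let the vertices of $C_n$ lying in ${\mathcal T}_n$ be $(a_0,b_0),(a_1,b_1),\dots,(a_s,b_s)$, labelled so that $a_0<a_1<\dots<a_s$. Then: (1) $(a_0,b_0)=(1,1)$; (2) $a_i<b_i$ for $i=1,\dots,s$; (3) $b_0<b_1<\dots<b_s$; (4) $b_i-a_i<b_{i+1}-a_{i+1}$ for $i=0,\dots,s-1$.
   Context: $G_n=\{(a,b)\in\mathbb{Z}^2 : ab\equiv 1 \pmod n,\ 1\le a,b\le n-1\}$ and $C_n\subset\mathbb{R}^2$ is its convex hull; vertices means extreme points of $C_n$. -}

module Defs where

open import Data.Nat using (ℕ; zero; suc)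
open import Data.Integer as ℤ using (ℤ; +_)
open import Data.Integer.Divisibility using (_∣_)
open import Data.Rational as ℚ using (ℚ; 0ℚ; 1ℚ)
open import Data.Fin using (Fin; zero; suc)
open import Data.Product using (_×_; _,_; proj₁; proj₂; Σ; ∃)
open import Relation.Binary.PropositionalEquality using (_≡_; _≢_)
open import Relation.Nullary using (¬_)

Point : Set
Point = ℤ × ℤ

InG : ℕ → Point → Set
InG n (a , b) =
  (+ 1 ℤ.≤ a) × (a ℤ.≤ + n ℤ.- + 1) ×
  (+ 1 ℤ.≤ b) × (b ℤ.≤ + n ℤ.- + 1) ×
  (+ n ∣ (a ℤ.* b ℤ.- + 1))

sumℚ : (k : ℕ) → (Fin k → ℚ) → ℚ
sumℚ zero    f = 0ℚ
sumℚ (suc k) f = f zero ℚ.+ sumℚ k (λ i → f (suc i))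

toℚ : ℤ → ℚ
toℚ z = z ℚ./ 1

InHullOfOthers : ℕ → Point → Set
InHullOfOthers n p =
  Σ ℕ λ k → Σ (Fin k → ℚ) λ w → Σ (Fin k → Point) λ q →
    (∀ i → InG n (q i) × q i ≢ p) ×
    (∀ i → 0ℚ ℚ.≤ w i) ×
    (sumℚ k w ≡ 1ℚ) ×
    (sumℚ k (λ i → w i ℚ.* toℚ (proj₁ (q i))) ≡ toℚ (proj₁ p)) ×
    (sumℚ k (λ i → w i ℚ.* toℚ (proj₂ (q i))) ≡ toℚ (proj₂ p))

-- p is a vertex (extreme point) of C_n = conv(G_n)
IsVertex : ℕ → Point → Set
IsVertex n p = InG n p × ¬ InHullOfOthers n p

InT : ℕ → Point → Set
InT n (a , b) = (+ 0 ℤ.≤ a) × (a ℤ.≤ b) × (a ℤ.+ b ℤ.≤ + n)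

{-# OPTIONS --safe #-}
module Submission where

-- Extremality in C_n is decidable because G_n is finite and integral: for p ∈ G_n, a planar Gordan
-- alternative applied to the vectors q - p (q ∈ G_n, q ≠ p) yields either a vanishing nonnegative
-- integer combination of them, which places p in the hull of the other points, or a direction c with
-- c·q < c·p for all of them, which makes p extreme. Filtering the grid in lexicographic order thus lists
-- the vertices lying in 𝒯_n, and since b ≡ a⁻¹ (mod n) is determined by a, their first coordinates
-- increase strictly. The list starts with (1, 1), exposed by the direction (-1, -1). A later vertex
-- cannot be some (a, a), a proper convex combination of (1, 1) and (n - 1, n - 1), so a < b. Finally,
-- if a < a′ but b′ - a′ ≤ b - a for consecutive vertices, then (a′, b′) lies in the trapezoid spanned
-- by (1, 1), (n - 1, n - 1), (a, b) and its reflection (n - b, n - a) ∈ G_n; so b - a increases, and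
-- with it b.

open import Defs

module IntegerInequalities where
  open import Data.Nat.Base using (z≤n; s≤s)
  open import Data.Integer.Base using (+_; +[1+_]; -[1+_]; 0ℤ; 1ℤ; _+_; _-_; _*_; -_; _≤_; _<_; +≤+; +<+)
  import Data.Integer.Properties as ℤₚ
  open import Data.Integer.Tactic.RingSolver using (solve-∀)
  open import Data.Empty using (⊥-elim)
  open import Relation.Binary.PropositionalEquality using (_≡_; _≢_; refl; subst; subst₂; sym)

  0≤i+j : ∀ {i j} → 0ℤ ≤ i → 0ℤ ≤ j → 0ℤ ≤ i + j
  0≤i+j = ℤₚ.+-mono-≤

  0<i+j : ∀ {i j} → 0ℤ < i → 0ℤ ≤ j → 0ℤ < i + j
  0<i+j = ℤₚ.+-mono-<-≤

  0≤i*j : ∀ {i j} → 0ℤ ≤ i → 0ℤ ≤ j → 0ℤ ≤ i * j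
  0≤i*j {+ m} {+ n} _ _ = subst (0ℤ ≤_) (ℤₚ.pos-* m n) (+≤+ z≤n)

  0<i*j : ∀ {i j} → 0ℤ < i → 0ℤ < j → 0ℤ < i * j
  0<i*j {+[1+ m ]} {+[1+ n ]} (+<+ _) (+<+ _) = +<+ (s≤s z≤n)

  0<i∧0≤i*j⇒0≤j : ∀ {i j} → 0ℤ < i → 0ℤ ≤ i * j → 0ℤ ≤ j
  0<i∧0≤i*j⇒0≤j {+ 0}      (+<+ ())
  0<i∧0≤i*j⇒0≤j {+[1+ m ]} {+ n}      _ _ = +≤+ z≤n
  0<i∧0≤i*j⇒0≤j {+[1+ m ]} { -[1+ n ]} _ ()

  0<i∧0<i*j⇒0<j : ∀ {i j} → 0ℤ < i → 0ℤ < i * j → 0ℤ < j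
  0<i∧0<i*j⇒0<j {+ 0}      (+<+ ())
  0<i∧0<i*j⇒0<j {+[1+ m ]} {+ 0}      _ 0<0 = subst (0ℤ <_) (ℤₚ.*-zeroʳ (+[1+ m ])) 0<0
  0<i∧0<i*j⇒0<j {+[1+ m ]} {+[1+ n ]} _ _   = +<+ (s≤s z≤n)
  0<i∧0<i*j⇒0<j {+[1+ m ]} { -[1+ n ]} _ ()

  0<i*x+j*y : ∀ {i j x y} → 0ℤ ≤ i → 0ℤ ≤ j → 0ℤ < i + j → 0ℤ < x → 0ℤ < y → 0ℤ < i * x + j * y
  0<i*x+j*y {+[1+ m ]} _ 0≤j _ 0<x 0<y = 0<i+j (0<i*j {+[1+ m ]} (+<+ (s≤s z≤n)) 0<x) (0≤i*j 0≤j (ℤₚ.<⇒≤ 0<y))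
  0<i*x+j*y {+ 0} {j} {x} {y} _ 0≤j 0<j _ 0<y =
    subst (0ℤ <_) (sym (ℤₚ.+-identityˡ (j * y))) (0<i*j (subst (0ℤ <_) (ℤₚ.+-identityˡ j) 0<j) 0<y)

  0≤i*i : ∀ i → 0ℤ ≤ i * i
  0≤i*i (+ n)      = 0≤i*j {+ n} {+ n} (+≤+ z≤n) (+≤+ z≤n)
  0≤i*i -[1+ n ]   = +≤+ z≤n

  0<i*i : ∀ i → i ≢ 0ℤ → 0ℤ < i * i
  0<i*i (+ 0)      i≢0 = ⊥-elim (i≢0 refl)
  0<i*i +[1+ n ]   _   = +<+ (s≤s z≤n)
  0<i*i -[1+ n ]   _   = +<+ (s≤s z≤n)

  i<j⇒0≤j-i-1 : ∀ {i j} → i < j → 0ℤ ≤ j - i - 1ℤ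
  i<j⇒0≤j-i-1 {i} {j} i<j = subst (0ℤ ≤_) (identity i j) (ℤₚ.i≤j⇒0≤j-i (ℤₚ.i<j⇒suc[i]≤j i<j))
    where
      identity : ∀ i j → j - (1ℤ + i) ≡ j - i - 1ℤ
      identity = solve-∀

  0≤j-i-1⇒i<j : ∀ {i j} → 0ℤ ≤ j - i - 1ℤ → i < j
  0≤j-i-1⇒i<j {i} {j} 0≤j-i-1 =
    ℤₚ.suc[i]≤j⇒i<j (ℤₚ.0≤i-j⇒j≤i (subst (0ℤ ≤_) (identity i j) 0≤j-i-1))
    where
      identity : ∀ i j → j - i - 1ℤ ≡ j - (1ℤ + i)
      identity = solve-∀

  i-j<0⇒i<j : ∀ {i j} → i - j < 0ℤ → i < j
  i-j<0⇒i<j {i} {j} i-j<0 = subst₂ _<_ (identity i j) (ℤₚ.+-identityˡ j) (ℤₚ.+-monoˡ-< j i-j<0)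
    where
      identity : ∀ i j → i - j + j ≡ i
      identity = solve-∀

  i<j⇒0<j-i : ∀ {i j} → i < j → 0ℤ < j - i
  i<j⇒0<j-i {i} {j} i<j = subst (_< j - i) (ℤₚ.+-inverseʳ i) (ℤₚ.+-monoˡ-< (- i) i<j)


module Plane where
  open import Data.Integer.Base using (ℤ; 0ℤ; _+_; _-_; _*_; -_; _<_)
  import Data.Integer.Properties as ℤₚ
  open import Data.Integer.Tactic.RingSolver using (solve-∀)
  open import Data.Product using (_,_; proj₁; proj₂)
  open import Data.Product.Properties using (≡-dec)
  open import Relation.Binary.Definitions using (DecidableEquality)
  open import Data.Empty using (⊥-elim)
  open import Relation.Binary.PropositionalEquality using (_≡_; _≢_; refl; trans; cong)
  open import Relation.Nullary using (yes; no)
  open IntegerInequalities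

  _≟ᴾ_ : DecidableEquality Point
  _≟ᴾ_ = ≡-dec ℤₚ._≟_ ℤₚ._≟_

  dot : Point → Point → ℤ
  dot (a , b) (c , d) = a * c + b * d

  cross : Point → Point → ℤ
  cross (a , b) (c , d) = a * d - b * c

  cross-self : ∀ p → cross p p ≡ 0ℤ
  cross-self (a , b) = identity a b
    where
      identity : ∀ a b → a * b - b * a ≡ 0ℤ
      identity = solve-∀

  cross-antisym : ∀ p q → cross p q ≡ - cross q p
  cross-antisym (a , b) (c , d) = identity a b c d
    where
      identity : ∀ a b c d → a * d - b * c ≡ - (c * b - d * a)
      identity = solve-∀

  dot-neg : ∀ p q → dot (- proj₁ p , - proj₂ p) q ≡ - dot p q
  dot-neg (a , b) (c , d) = identity a b c d
    where
      identity : ∀ a b c d → - a * c + - b * d ≡ - (a * c + b * d)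
      identity = solve-∀

  dot-self-pos : ∀ p → p ≢ (0ℤ , 0ℤ) → 0ℤ < dot p p
  dot-self-pos (a , b) p≢0 with a ℤₚ.≟ 0ℤ | b ℤₚ.≟ 0ℤ
  ... | no a≢0   | _        = 0<i+j (0<i*i a a≢0) (0≤i*i b)
  ... | yes refl | no b≢0   = ℤₚ.+-mono-≤-< (0≤i*i 0ℤ) (0<i*i b b≢0)
  ... | yes refl | yes refl = ⊥-elim (p≢0 refl)

  dot-cone-normal : ∀ u v q → dot (proj₂ u - proj₂ v , proj₁ v - proj₁ u) q ≡ - (cross u q + cross q v)
  dot-cone-normal (a , b) (c , d) (x , y) = identity a b c d x y
    where
      identity : ∀ a b c d x y → (b - d) * x + (c - a) * y ≡ - ((a * y - b * x) + (x * d - y * c))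
      identity = solve-∀

  ray-vanishingˣ : ∀ e w → dot e e * proj₁ w + (- dot e w * proj₁ e + 0ℤ) ≡ - cross e w * proj₂ e
  ray-vanishingˣ (a , b) (x , y) = identity a b x y
    where
      identity : ∀ a b x y → (a * a + b * b) * x + (- (a * x + b * y) * a + 0ℤ) ≡ - (a * y - b * x) * b
      identity = solve-∀

  ray-vanishingʸ : ∀ e w → dot e e * proj₂ w + (- dot e w * proj₂ e + 0ℤ) ≡ cross e w * proj₁ e
  ray-vanishingʸ (a , b) (x , y) = identity a b x y
    where
      identity : ∀ a b x y → (a * a + b * b) * y + (- (a * x + b * y) * b + 0ℤ) ≡ (a * y - b * x) * a
      identity = solve-∀

  cramerˣ : ∀ u v w → cross u v * proj₁ w + (- cross w v * proj₁ u + (- cross u w * proj₁ v + 0ℤ)) ≡ 0ℤ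
  cramerˣ (a , b) (c , d) (x , y) = identity a b c d x y
    where
      identity : ∀ a b c d x y →
        (a * d - b * c) * x + (- (x * d - y * c) * a + (- (a * y - b * x) * c + 0ℤ)) ≡ 0ℤ
      identity = solve-∀

  cramerʸ : ∀ u v w → cross u v * proj₂ w + (- cross w v * proj₂ u + (- cross u w * proj₂ v + 0ℤ)) ≡ 0ℤ
  cramerʸ (a , b) (c , d) (x , y) = identity a b c d x y
    where
      identity : ∀ a b c d x y →
        (a * d - b * c) * y + (- (x * d - y * c) * b + (- (a * y - b * x) * d + 0ℤ)) ≡ 0ℤ
      identity = solve-∀

  -- Expand q and w in the orthogonal frame (e, e⊥) with e⊥ = (- proj₂ e , proj₁ e).
  cross-on-rayʳ : ∀ e q w → cross e q ≡ 0ℤ → dot e e * cross q w ≡ dot e q * cross e w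
  cross-on-rayʳ e@(a , b) q@(c , d) w@(x , y) eq≡0 =
    trans (identity a b c d x y)
      (trans (cong (λ z → dot e q * cross e w - z * dot e w) eq≡0) (ℤₚ.+-identityʳ (dot e q * cross e w)))
    where
      identity : ∀ a b c d x y → (a * a + b * b) * (c * y - d * x) ≡
        (a * c + b * d) * (a * y - b * x) - (a * d - b * c) * (a * x + b * y)
      identity = solve-∀

  cross-on-rayˡ : ∀ e q w → cross e q ≡ 0ℤ → dot e e * cross w q ≡ dot e q * cross w e
  cross-on-rayˡ e@(a , b) q@(c , d) w@(x , y) eq≡0 =
    trans (identity a b c d x y)
      (trans (cong (λ z → dot e q * cross w e + z * dot e w) eq≡0) (ℤₚ.+-identityʳ (dot e q * cross w e)))
    where
      identity : ∀ a b c d x y → (a * a + b * b) * (x * d - y * c) ≡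
        (a * c + b * d) * (x * b - y * a) + (a * d - b * c) * (a * x + b * y)
      identity = solve-∀

  plückerˡ : ∀ u v w q → cross u v * cross w q ≡ cross u q * cross w v + cross q v * cross w u
  plückerˡ (a , b) (c , d) (x , y) (s , t) = identity a b c d x y s t
    where
      identity : ∀ a b c d x y s t → (a * d - b * c) * (x * t - y * s) ≡
        (a * t - b * s) * (x * d - y * c) + (s * d - t * c) * (x * b - y * a)
      identity = solve-∀

  plückerˡ-sum : ∀ u v w q → cross u v * (cross w q + cross q v) ≡
    cross u q * cross w v + cross q v * (cross w u + cross u v)
  plückerˡ-sum (a , b) (c , d) (x , y) (s , t) = identity a b c d x y s t
    where
      identity : ∀ a b c d x y s t → (a * d - b * c) * ((x * t - y * s) + (s * d - t * c)) ≡
        (a * t - b * s) * (x * d - y * c) + (s * d - t * c) * ((x * b - y * a) + (a * d - b * c))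
      identity = solve-∀

  plückerʳ : ∀ u v w q → cross u v * cross q w ≡ cross u q * cross v w + cross q v * cross u w
  plückerʳ (a , b) (c , d) (x , y) (s , t) = identity a b c d x y s t
    where
      identity : ∀ a b c d x y s t → (a * d - b * c) * (s * y - t * x) ≡
        (a * t - b * s) * (c * y - d * x) + (s * d - t * c) * (a * y - b * x)
      identity = solve-∀

  plückerʳ-sum : ∀ u v w q → cross u v * (cross u q + cross q w) ≡
    cross u q * (cross u v + cross v w) + cross q v * cross u w
  plückerʳ-sum (a , b) (c , d) (x , y) (s , t) = identity a b c d x y s t
    where
      identity : ∀ a b c d x y s t → (a * d - b * c) * ((a * t - b * s) + (s * y - t * x)) ≡
        (a * t - b * s) * ((a * d - b * c) + (c * y - d * x)) + (s * d - t * c) * (a * y - b * x)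
      identity = solve-∀

module ConvexCombination where
  open import Data.Nat.Base using (ℕ; zero; suc)
  open import Data.Integer.Base using (ℤ; +_; +[1+_]; 0ℤ; _+_; _-_; _*_; _≤_; _<_; +<+; pred)
  import Data.Integer.Properties as ℤₚ
  open import Data.Integer.Tactic.RingSolver using (solve-∀)
  open import Data.Rational.Base as ℚ using (ℚ; 0ℚ; 1ℚ)
  import Data.Rational.Properties as ℚₚ
  import Data.Rational.Unnormalised.Base as ℚᵘ
  import Data.Rational.Unnormalised.Properties as ℚᵘₚ
  open import Data.Rational.Solver using (module +-*-Solver)
  open import Data.Fin.Base using (Fin; zero; suc)
  open import Data.Product using (_×_; _,_; proj₁; proj₂)
  open import Relation.Binary.PropositionalEquality
  open import Relation.Nullary using (¬_)

  open +-*-Solver using (solve; _:=_; _:+_; _:*_)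
  open Plane using (dot)

  sumℤ : (k : ℕ) → (Fin k → ℤ) → ℤ
  sumℤ zero    f = 0ℤ
  sumℤ (suc k) f = f zero + sumℤ k (λ i → f (suc i))

  sumℤ-*-shift : ∀ k (c x : Fin k → ℤ) y →
    sumℤ k (λ i → c i * (x i - y)) ≡ sumℤ k (λ i → c i * x i) - sumℤ k c * y
  sumℤ-*-shift zero    c x y = refl
  sumℤ-*-shift (suc k) c x y =
    trans (cong (_+_ (c zero * (x zero - y))) (sumℤ-*-shift k (λ i → c (suc i)) (λ i → x (suc i)) y))
          (distrib (c zero) (x zero) y _ _)
    where
      distrib : ∀ c x y s t → c * (x - y) + (s - t * y) ≡ c * x + s - (c + t) * y
      distrib = solve-∀

  -- toℚ z normalises mkℚᵘ z 0, so the arithmetic of toℚ is inherited from ℚᵘ.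
  toℚ≃ : ∀ z → ℚ.toℚᵘ (toℚ z) ℚᵘ.≃ ℚᵘ.mkℚᵘ z 0
  toℚ≃ z = ℚₚ.toℚᵘ-fromℚᵘ (ℚᵘ.mkℚᵘ z 0)

  toℚ-+ : ∀ x y → toℚ (x + y) ≡ toℚ x ℚ.+ toℚ y
  toℚ-+ x y = ℚₚ.toℚᵘ-injective (begin
    ℚ.toℚᵘ (toℚ (x + y))               ≈⟨ toℚ≃ (x + y) ⟩
    ℚᵘ.mkℚᵘ (x + y) 0                   ≈⟨ ℚᵘ.*≡* (cross-multiplied x y) ⟩
    ℚᵘ.mkℚᵘ x 0 ℚᵘ.+ ℚᵘ.mkℚᵘ y 0        ≈⟨ ℚᵘₚ.+-cong (toℚ≃ x) (toℚ≃ y) ⟨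
    ℚ.toℚᵘ (toℚ x) ℚᵘ.+ ℚ.toℚᵘ (toℚ y)  ≈⟨ ℚₚ.toℚᵘ-homo-+ (toℚ x) (toℚ y) ⟨
    ℚ.toℚᵘ (toℚ x ℚ.+ toℚ y)            ∎)
    where
      open ℚᵘₚ.≃-Reasoning
      cross-multiplied : ∀ x y → (x + y) * (+ 1 * + 1) ≡ (x * + 1 + y * + 1) * + 1
      cross-multiplied = solve-∀

  toℚ-* : ∀ x y → toℚ (x * y) ≡ toℚ x ℚ.* toℚ y
  toℚ-* x y = ℚₚ.toℚᵘ-injective (begin
    ℚ.toℚᵘ (toℚ (x * y))               ≈⟨ toℚ≃ (x * y) ⟩
    ℚᵘ.mkℚᵘ (x * y) 0                   ≈⟨ ℚᵘ.*≡* (cross-multiplied x y) ⟩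
    ℚᵘ.mkℚᵘ x 0 ℚᵘ.* ℚᵘ.mkℚᵘ y 0        ≈⟨ ℚᵘₚ.*-cong (toℚ≃ x) (toℚ≃ y) ⟨
    ℚ.toℚᵘ (toℚ x) ℚᵘ.* ℚ.toℚᵘ (toℚ y)  ≈⟨ ℚₚ.toℚᵘ-homo-* (toℚ x) (toℚ y) ⟨
    ℚ.toℚᵘ (toℚ x ℚ.* toℚ y)            ∎)
    where
      open ℚᵘₚ.≃-Reasoning
      cross-multiplied : ∀ x y → (x * y) * (+ 1 * + 1) ≡ (x * y) * + 1
      cross-multiplied = solve-∀

  toℚ-mono-≤ : ∀ {x y} → x ≤ y → toℚ x ℚ.≤ toℚ y
  toℚ-mono-≤ {x} {y} x≤y = ℚₚ.toℚᵘ-cancel-≤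
    (ℚᵘₚ.≤-respʳ-≃ (ℚᵘₚ.≃-sym (toℚ≃ y)) (ℚᵘₚ.≤-respˡ-≃ (ℚᵘₚ.≃-sym (toℚ≃ x))
      (ℚᵘ.*≤* (subst₂ _≤_ (sym (ℤₚ.*-identityʳ x)) (sym (ℤₚ.*-identityʳ y)) x≤y))))

  toℚ-cancel-≤ : ∀ {x y} → toℚ x ℚ.≤ toℚ y → x ≤ y
  toℚ-cancel-≤ {x} {y} x≤y
    with ℚᵘₚ.≤-respʳ-≃ (toℚ≃ y) (ℚᵘₚ.≤-respˡ-≃ (toℚ≃ x) (ℚₚ.toℚᵘ-mono-≤ x≤y))
  ... | ℚᵘ.*≤* x*1≤y*1 = subst₂ _≤_ (ℤₚ.*-identityʳ x) (ℤₚ.*-identityʳ y) x*1≤y*1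

  toℚ-sumℤ : ∀ k f → toℚ (sumℤ k f) ≡ sumℚ k (λ i → toℚ (f i))
  toℚ-sumℤ zero    f = refl
  toℚ-sumℤ (suc k) f = trans (toℚ-+ (f zero) _) (cong (toℚ (f zero) ℚ.+_) (toℚ-sumℤ k (λ i → f (suc i))))

  sumℚ-cong : ∀ k {f g : Fin k → ℚ} → (∀ i → f i ≡ g i) → sumℚ k f ≡ sumℚ k g
  sumℚ-cong zero    f≡g = refl
  sumℚ-cong (suc k) f≡g = cong₂ ℚ._+_ (f≡g zero) (sumℚ-cong k (λ i → f≡g (suc i)))

  sumℚ-+ : ∀ k (f g : Fin k → ℚ) → sumℚ k (λ i → f i ℚ.+ g i) ≡ sumℚ k f ℚ.+ sumℚ k g
  sumℚ-+ zero    f g = refl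
  sumℚ-+ (suc k) f g = trans (cong ((f zero ℚ.+ g zero) ℚ.+_) (sumℚ-+ k (λ i → f (suc i)) (λ i → g (suc i))))
    (interchange (f zero) (g zero) _ _)
    where
      interchange : ∀ a b c d → a ℚ.+ b ℚ.+ (c ℚ.+ d) ≡ a ℚ.+ c ℚ.+ (b ℚ.+ d)
      interchange = solve 4 (λ a b c d → a :+ b :+ (c :+ d) := a :+ c :+ (b :+ d)) refl

  sumℚ-*ˡ : ∀ k a (f : Fin k → ℚ) → sumℚ k (λ i → a ℚ.* f i) ≡ a ℚ.* sumℚ k f
  sumℚ-*ˡ zero    a f = sym (ℚₚ.*-zeroʳ a)
  sumℚ-*ˡ (suc k) a f = trans (cong ((a ℚ.* f zero) ℚ.+_) (sumℚ-*ˡ k a (λ i → f (suc i))))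
    (sym (ℚₚ.*-distribˡ-+ a (f zero) _))

  sumℚ-*ʳ : ∀ k a (f : Fin k → ℚ) → sumℚ k (λ i → f i ℚ.* a) ≡ sumℚ k f ℚ.* a
  sumℚ-*ʳ k a f = trans (sumℚ-cong k (λ i → ℚₚ.*-comm (f i) a)) (trans (sumℚ-*ˡ k a f) (ℚₚ.*-comm a _))

  sumℚ-mono-≤ : ∀ k {f g : Fin k → ℚ} → (∀ i → f i ℚ.≤ g i) → sumℚ k f ℚ.≤ sumℚ k g
  sumℚ-mono-≤ zero    f≤g = ℚₚ.≤-refl
  sumℚ-mono-≤ (suc k) f≤g = ℚₚ.+-mono-≤ (f≤g zero) (sumℚ-mono-≤ k (λ i → f≤g (suc i)))

  separated⇒¬InHullOfOthers : ∀ n p c → (∀ q → InG n q → q ≢ p → dot c q < dot c p) → ¬ InHullOfOthers n p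
  separated⇒¬InHullOfOthers n p c below (k , w , q , q∈G , w≥0 , Σw≡1 , Σwx≡px , Σwy≡py) =
    ℤₚ.<-irrefl refl (ℤₚ.i≤pred[j]⇒i<j (toℚ-cancel-≤ {dot c p} level≤pred))
    where
      open ≡-Reasoning
      α β : ℚ
      α = toℚ (proj₁ c)
      β = toℚ (proj₂ c)
      x y : Fin k → ℚ
      x i = toℚ (proj₁ (q i))
      y i = toℚ (proj₂ (q i))
      toℚ-dot : ∀ r → toℚ (dot c r) ≡ α ℚ.* toℚ (proj₁ r) ℚ.+ β ℚ.* toℚ (proj₂ r)
      toℚ-dot r = trans (toℚ-+ (proj₁ c * proj₁ r) (proj₂ c * proj₂ r))
        (cong₂ ℚ._+_ (toℚ-* (proj₁ c) (proj₁ r)) (toℚ-* (proj₂ c) (proj₂ r)))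
      rearrange : ∀ w a b x y → w ℚ.* (a ℚ.* x ℚ.+ b ℚ.* y) ≡ a ℚ.* (w ℚ.* x) ℚ.+ b ℚ.* (w ℚ.* y)
      rearrange = solve 5 (λ w a b x y → w :* (a :* x :+ b :* y) := a :* (w :* x) :+ b :* (w :* y)) refl
      averaged-level : sumℚ k (λ i → w i ℚ.* toℚ (dot c (q i))) ≡ toℚ (dot c p)
      averaged-level = begin
        sumℚ k (λ i → w i ℚ.* toℚ (dot c (q i)))
          ≡⟨ sumℚ-cong k (λ i → trans (cong (w i ℚ.*_) (toℚ-dot (q i))) (rearrange (w i) α β (x i) (y i))) ⟩
        sumℚ k (λ i → α ℚ.* (w i ℚ.* x i) ℚ.+ β ℚ.* (w i ℚ.* y i))
          ≡⟨ sumℚ-+ k (λ i → α ℚ.* (w i ℚ.* x i)) (λ i → β ℚ.* (w i ℚ.* y i)) ⟩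
        sumℚ k (λ i → α ℚ.* (w i ℚ.* x i)) ℚ.+ sumℚ k (λ i → β ℚ.* (w i ℚ.* y i))
          ≡⟨ cong₂ ℚ._+_ (sumℚ-*ˡ k α (λ i → w i ℚ.* x i)) (sumℚ-*ˡ k β (λ i → w i ℚ.* y i)) ⟩
        α ℚ.* sumℚ k (λ i → w i ℚ.* x i) ℚ.+ β ℚ.* sumℚ k (λ i → w i ℚ.* y i)
          ≡⟨ cong₂ (λ u v → α ℚ.* u ℚ.+ β ℚ.* v) Σwx≡px Σwy≡py ⟩
        α ℚ.* toℚ (proj₁ p) ℚ.+ β ℚ.* toℚ (proj₂ p)
          ≡⟨ toℚ-dot p ⟨
        toℚ (dot c p) ∎
      term≤ : ∀ i → w i ℚ.* toℚ (dot c (q i)) ℚ.≤ w i ℚ.* toℚ (pred (dot c p))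
      term≤ i = ℚₚ.*-monoˡ-≤-nonNeg (w i) {{ℚ.nonNegative (w≥0 i)}}
        (toℚ-mono-≤ (ℤₚ.i<j⇒i≤pred[j] (below (q i) (proj₁ (q∈G i)) (proj₂ (q∈G i)))))
      level≤pred : toℚ (dot c p) ℚ.≤ toℚ (pred (dot c p))
      level≤pred = subst (ℚ._≤ toℚ (pred (dot c p))) averaged-level
        (ℚₚ.≤-trans (sumℚ-mono-≤ k term≤) (ℚₚ.≤-reflexive
          (trans (sumℚ-*ʳ k (toℚ (pred (dot c p))) w)
                 (trans (cong (ℚ._* toℚ (pred (dot c p))) Σw≡1) (ℚₚ.*-identityˡ _)))))

  integerCombination⇒InHullOfOthers : ∀ n p k (c : Fin k → ℤ) (q : Fin k → Point) →
    (∀ i → InG n (q i) × q i ≢ p) → (∀ i → 0ℤ ≤ c i) → 0ℤ < sumℤ k c →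
    sumℤ k (λ i → c i * proj₁ (q i)) ≡ sumℤ k c * proj₁ p →
    sumℤ k (λ i → c i * proj₂ (q i)) ≡ sumℤ k c * proj₂ p →
    InHullOfOthers n p
  integerCombination⇒InHullOfOthers n p k c q q∈G c≥0 Σc>0 Σcx≡Σc*px Σcy≡Σc*py =
    scaleBy (sumℤ k c) refl Σc>0
    where
      scaleBy : ∀ K → sumℤ k c ≡ K → 0ℤ < K → InHullOfOthers n p
      scaleBy (+ zero) _ (+<+ ())
      scaleBy K@(+[1+ K-1 ]) Σc≡K _ =
        k , w , q , q∈G , w≥0 , Σw≡1 , coordinate Σcx≡Σc*px , coordinate Σcy≡Σc*py
        where
          instance
            K>0 : ℚ.Positive (toℚ K)
            K>0 = ℚₚ.normalize-pos (suc K-1) 1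
            K≢0 : ℚ.NonZero (toℚ K)
            K≢0 = ℚₚ.pos⇒nonZero (toℚ K)
          r : ℚ
          r = ℚ.1/ (toℚ K)
          Kr≡1 : toℚ K ℚ.* r ≡ 1ℚ
          Kr≡1 = ℚₚ.*-inverseʳ (toℚ K)
          w : Fin k → ℚ
          w i = toℚ (c i) ℚ.* r
          w≥0 : ∀ i → 0ℚ ℚ.≤ w i
          w≥0 i = ℚₚ.nonNegative⁻¹ (w i)
            {{ℚₚ.nonNeg*nonNeg⇒nonNeg (toℚ (c i)) {{ℚ.nonNegative (toℚ-mono-≤ (c≥0 i))}}
                                      r {{ℚₚ.pos⇒nonNeg r {{ℚₚ.1/pos⇒pos (toℚ K)}}}}}}
          Σw≡1 : sumℚ k w ≡ 1ℚ
          Σw≡1 = trans (sumℚ-*ʳ k r _)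
                       (trans (cong (ℚ._* r) (trans (sym (toℚ-sumℤ k c)) (cong toℚ Σc≡K))) Kr≡1)
          coordinate : ∀ {x : Fin k → ℤ} {px} → sumℤ k (λ i → c i * x i) ≡ sumℤ k c * px →
                       sumℚ k (λ i → w i ℚ.* toℚ (x i)) ≡ toℚ px
          coordinate {x} {px} Σcx≡Σc*px = begin
            sumℚ k (λ i → w i ℚ.* toℚ (x i))
              ≡⟨ sumℚ-cong k (λ i → trans (reassoc (toℚ (c i)) r (toℚ (x i)))
                                           (cong (r ℚ.*_) (sym (toℚ-* (c i) (x i))))) ⟩
            sumℚ k (λ i → r ℚ.* toℚ (c i * x i))
              ≡⟨ trans (sumℚ-*ˡ k r _) (cong (r ℚ.*_) (sym (toℚ-sumℤ k _))) ⟩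
            r ℚ.* toℚ (sumℤ k (λ i → c i * x i))
              ≡⟨ cong (λ z → r ℚ.* toℚ z) (trans Σcx≡Σc*px (cong (_* px) Σc≡K)) ⟩
            r ℚ.* toℚ (K * px)
              ≡⟨ trans (cong (r ℚ.*_) (toℚ-* K px)) (reassoc′ r (toℚ K) (toℚ px)) ⟩
            (toℚ K ℚ.* r) ℚ.* toℚ px
              ≡⟨ trans (cong (ℚ._* toℚ px) Kr≡1) (ℚₚ.*-identityˡ (toℚ px)) ⟩
            toℚ px ∎
            where
              open ≡-Reasoning
              reassoc : ∀ a r x → a ℚ.* r ℚ.* x ≡ r ℚ.* (a ℚ.* x)
              reassoc = solve 3 (λ a r x → a :* r :* x := r :* (a :* x)) refl
              reassoc′ : ∀ r a x → r ℚ.* (a ℚ.* x) ≡ (a ℚ.* r) ℚ.* x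
              reassoc′ = solve 3 (λ r a x → r :* (a :* x) := (a :* r) :* x) refl

module ConicAlternative {A : Set} (f : A → Point) where
  open import Data.Nat.Base using (ℕ; z≤n; s≤s)
  open import Data.Integer.Base using (ℤ; +_; 0ℤ; _+_; _-_; _*_; -_; _≤_; _<_; +≤+; +<+)
  import Data.Integer.Properties as ℤₚ
  open import Data.Fin.Base using (Fin; zero; suc)
  open import Data.Vec.Base using ([]; _∷_; lookup)
  open import Data.List.Base using (List; []; _∷_)
  open import Data.List.Membership.Propositional using (_∈_)
  open import Data.List.Relation.Unary.Any using (here; there)
  open import Data.Product using (Σ; _×_; _,_; proj₁; proj₂)
  open import Data.Sum using (_⊎_; inj₁; inj₂)
  open import Relation.Binary.Definitions using (Tri; tri<; tri≈; tri>)
  open import Relation.Binary.PropositionalEquality using (_≡_; refl; sym; trans; cong; subst)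
  open import Relation.Nullary using (yes; no)
  open Plane
  open IntegerInequalities
  open ConvexCombination using (sumℤ)

  record ZeroCombination (S : List A) : Set where
    field
      size     : ℕ
      coeff    : Fin size → ℤ
      vector   : Fin size → A
      vector∈S : ∀ i → vector i ∈ S
      coeff≥0  : ∀ i → 0ℤ ≤ coeff i
      Σcoeff>0 : 0ℤ < sumℤ size coeff
      Σˣ≡0     : sumℤ size (λ i → coeff i * proj₁ (f (vector i))) ≡ 0ℤ
      Σʸ≡0     : sumℤ size (λ i → coeff i * proj₂ (f (vector i))) ≡ 0ℤ

  SeparatingDirection : List A → Set
  SeparatingDirection S = Σ Point λ c → ∀ {q} → q ∈ S → dot c (f q) < 0ℤ

  OnRay : Point → Point → Set
  OnRay e w = cross e w ≡ 0ℤ × 0ℤ < dot e w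

  -- The strict inequality excludes w = 0, and makes the cone normal of u, v strictly separating.
  InCone : Point → Point → Point → Set
  InCone u v w = 0ℤ ≤ cross u w × 0ℤ ≤ cross w v × 0ℤ < cross u w + cross w v

  InCone-leftEdge : ∀ u v w → cross u w ≡ 0ℤ → 0ℤ < cross w v → InCone u v w
  InCone-leftEdge u v w uw≡0 0<wv rewrite uw≡0 =
    ℤₚ.≤-refl , ℤₚ.<⇒≤ 0<wv , subst (0ℤ <_) (sym (ℤₚ.+-identityˡ (cross w v))) 0<wv

  InCone-rightEdge : ∀ u v w → 0ℤ < cross u w → cross w v ≡ 0ℤ → InCone u v w
  InCone-rightEdge u v w 0<uw wv≡0 rewrite wv≡0 =
    ℤₚ.<⇒≤ 0<uw , ℤₚ.≤-refl , subst (0ℤ <_) (sym (ℤₚ.+-identityʳ (cross u w))) 0<uw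

  InCone-widenˡ : ∀ u v w q → 0ℤ < cross u v → cross u w < 0ℤ → 0ℤ < cross w v →
                  InCone u v q → InCone w v q
  InCone-widenˡ u v w q 0<uv uw<0 0<wv (0≤uq , 0≤qv , 0<uq+qv) = 0≤wq , 0≤qv , 0<wq+qv
    where
      0<wu : 0ℤ < cross w u
      0<wu = subst (0ℤ <_) (sym (cross-antisym w u)) (ℤₚ.neg-mono-< uw<0)
      0≤wq : 0ℤ ≤ cross w q
      0≤wq = 0<i∧0≤i*j⇒0≤j 0<uv (subst (0ℤ ≤_) (sym (plückerˡ u v w q))
        (0≤i+j (0≤i*j 0≤uq (ℤₚ.<⇒≤ 0<wv)) (0≤i*j 0≤qv (ℤₚ.<⇒≤ 0<wu))))
      0<wq+qv : 0ℤ < cross w q + cross q v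
      0<wq+qv = 0<i∧0<i*j⇒0<j 0<uv (subst (0ℤ <_) (sym (plückerˡ-sum u v w q))
        (0<i*x+j*y 0≤uq 0≤qv 0<uq+qv 0<wv (0<i+j 0<wu (ℤₚ.<⇒≤ 0<uv))))

  InCone-widenʳ : ∀ u v w q → 0ℤ < cross u v → 0ℤ < cross u w → cross w v < 0ℤ →
                  InCone u v q → InCone u w q
  InCone-widenʳ u v w q 0<uv 0<uw wv<0 (0≤uq , 0≤qv , 0<uq+qv) = 0≤uq , 0≤qw , 0<uq+qw
    where
      0<vw : 0ℤ < cross v w
      0<vw = subst (0ℤ <_) (sym (cross-antisym v w)) (ℤₚ.neg-mono-< wv<0)
      0≤qw : 0ℤ ≤ cross q w
      0≤qw = 0<i∧0≤i*j⇒0≤j 0<uv (subst (0ℤ ≤_) (sym (plückerʳ u v w q))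
        (0≤i+j (0≤i*j 0≤uq (ℤₚ.<⇒≤ 0<vw)) (0≤i*j 0≤qv (ℤₚ.<⇒≤ 0<uw))))
      0<uq+qw : 0ℤ < cross u q + cross q w
      0<uq+qw = 0<i∧0<i*j⇒0<j 0<uv (subst (0ℤ <_) (sym (plückerʳ-sum u v w q))
        (0<i*x+j*y 0≤uq 0≤qv 0<uq+qv (0<i+j 0<uv (ℤₚ.<⇒≤ 0<vw)) 0<uw))

  zeroVector : ∀ {S} w → f w ≡ (0ℤ , 0ℤ) → ZeroCombination (w ∷ S)
  zeroVector w fw≡0 = record
    { size = 1 ; coeff = λ _ → + 1 ; vector = λ _ → w ; vector∈S = λ _ → here refl
    ; coeff≥0 = λ _ → +≤+ z≤n ; Σcoeff>0 = +<+ (s≤s z≤n)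
    ; Σˣ≡0 = cong (λ p → + 1 * proj₁ p + 0ℤ) fw≡0 ; Σʸ≡0 = cong (λ p → + 1 * proj₂ p + 0ℤ) fw≡0 }

  oppositeToRay : ∀ {S} w e → e ∈ S → 0ℤ < dot (f e) (f e) →
                  cross (f e) (f w) ≡ 0ℤ → dot (f e) (f w) ≤ 0ℤ → ZeroCombination (w ∷ S)
  oppositeToRay w e e∈S 0<ee ew≡0 ew≤0 = record
    { size = 2 ; coeff = lookup (dot (f e) (f e) ∷ - dot (f e) (f w) ∷ []) ; vector = lookup (w ∷ e ∷ [])
    ; vector∈S = λ { zero → here refl ; (suc zero) → there e∈S }
    ; coeff≥0 = λ { zero → ℤₚ.<⇒≤ 0<ee ; (suc zero) → ℤₚ.neg-mono-≤ ew≤0 }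
    ; Σcoeff>0 = 0<i+j 0<ee (0≤i+j (ℤₚ.neg-mono-≤ ew≤0) ℤₚ.≤-refl)
    ; Σˣ≡0 = trans (ray-vanishingˣ (f e) (f w)) (cong (λ z → - z * proj₂ (f e)) ew≡0)
    ; Σʸ≡0 = trans (ray-vanishingʸ (f e) (f w)) (cong (λ z → z * proj₁ (f e)) ew≡0) }

  oppositeToCone : ∀ {S} w e₁ e₂ → e₁ ∈ S → e₂ ∈ S → 0ℤ < cross (f e₁) (f e₂) →
                   cross (f e₁) (f w) ≤ 0ℤ → cross (f w) (f e₂) ≤ 0ℤ → ZeroCombination (w ∷ S)
  oppositeToCone w e₁ e₂ e₁∈S e₂∈S 0<X α≤0 β≤0 = record
    { size = 3
    ; coeff = lookup (cross (f e₁) (f e₂) ∷ - cross (f w) (f e₂) ∷ - cross (f e₁) (f w) ∷ [])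
    ; vector = lookup (w ∷ e₁ ∷ e₂ ∷ [])
    ; vector∈S = λ { zero → here refl ; (suc zero) → there e₁∈S ; (suc (suc zero)) → there e₂∈S }
    ; coeff≥0 = λ { zero             → ℤₚ.<⇒≤ 0<X
                  ; (suc zero)       → ℤₚ.neg-mono-≤ β≤0
                  ; (suc (suc zero)) → ℤₚ.neg-mono-≤ α≤0 }
    ; Σcoeff>0 = 0<i+j 0<X (0≤i+j (ℤₚ.neg-mono-≤ β≤0) (0≤i+j (ℤₚ.neg-mono-≤ α≤0) ℤₚ.≤-refl))
    ; Σˣ≡0 = cramerˣ (f e₁) (f e₂) (f w)
    ; Σʸ≡0 = cramerʸ (f e₁) (f e₂) (f w) }

  ZeroCombination-∷ : ∀ {S} w → ZeroCombination S → ZeroCombination (w ∷ S)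
  ZeroCombination-∷ w z = record
    { size = size ; coeff = coeff ; vector = vector ; vector∈S = λ i → there (vector∈S i)
    ; coeff≥0 = coeff≥0 ; Σcoeff>0 = Σcoeff>0 ; Σˣ≡0 = Σˣ≡0 ; Σʸ≡0 = Σʸ≡0 }
    where open ZeroCombination z

  -- The invariant of a scan through a list: a vanishing combination has been found, or all vectors
  -- seen so far lie on one open ray, or in a cone of opening less than π.
  data ConeScan : List A → Set where
    none      : ConeScan []
    vanishing : ∀ {S} → ZeroCombination S → ConeScan S
    ray       : ∀ {S} e → e ∈ S → (∀ {q} → q ∈ S → OnRay (f e) (f q)) → ConeScan S
    cone      : ∀ {S} e₁ e₂ → e₁ ∈ S → e₂ ∈ S → 0ℤ < cross (f e₁) (f e₂) →
                (∀ {q} → q ∈ S → InCone (f e₁) (f e₂) (f q)) → ConeScan S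

  extendRay : ∀ {S} w e → e ∈ S → (∀ {q} → q ∈ S → OnRay (f e) (f q)) → ConeScan (w ∷ S)
  extendRay {S} w e e∈S onRay with ℤₚ.<-cmp 0ℤ (cross (f e) (f w)) | 0ℤ ℤₚ.<? dot (f e) (f w)
  ... | tri≈ _ 0≡γ _ | yes 0<δ = ray e (there e∈S) onRay′
    where
      onRay′ : ∀ {q} → q ∈ w ∷ S → OnRay (f e) (f q)
      onRay′ (here refl) = sym 0≡γ , 0<δ
      onRay′ (there q∈S) = onRay q∈S
  ... | tri≈ _ 0≡γ _ | no 0≮δ =
    vanishing (oppositeToRay w e e∈S (proj₂ (onRay e∈S)) (sym 0≡γ) (ℤₚ.≮⇒≥ 0≮δ))
  ... | tri< 0<γ _ _ | _ = cone e w (there e∈S) (here refl) 0<γ inCone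
    where
      inCone : ∀ {q} → q ∈ w ∷ S → InCone (f e) (f w) (f q)
      inCone (here refl) = InCone-rightEdge (f e) (f w) (f w) 0<γ (cross-self (f w))
      inCone {q} (there q∈S) = InCone-leftEdge (f e) (f w) (f q) eq≡0 (0<i∧0<i*j⇒0<j (proj₂ (onRay e∈S))
        (subst (0ℤ <_) (sym (cross-on-rayʳ (f e) (f q) (f w) eq≡0)) (0<i*j (proj₂ (onRay q∈S)) 0<γ)))
        where eq≡0 = proj₁ (onRay q∈S)
  ... | tri> _ _ γ<0 | _ = cone w e (here refl) (there e∈S) 0<we inCone
    where
      0<we : 0ℤ < cross (f w) (f e)
      0<we = subst (0ℤ <_) (sym (cross-antisym (f w) (f e))) (ℤₚ.neg-mono-< γ<0)
      inCone : ∀ {q} → q ∈ w ∷ S → InCone (f w) (f e) (f q)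
      inCone (here refl) = InCone-leftEdge (f w) (f e) (f w) (cross-self (f w)) 0<we
      inCone {q} (there q∈S) = InCone-rightEdge (f w) (f e) (f q)
        (0<i∧0<i*j⇒0<j (proj₂ (onRay e∈S))
          (subst (0ℤ <_) (sym (cross-on-rayˡ (f e) (f q) (f w) eq≡0)) (0<i*j (proj₂ (onRay q∈S)) 0<we)))
        (trans (cross-antisym (f q) (f e)) (cong -_ eq≡0))
        where eq≡0 = proj₁ (onRay q∈S)

  extendCone : ∀ {S} w e₁ e₂ → e₁ ∈ S → e₂ ∈ S → 0ℤ < cross (f e₁) (f e₂) →
               (∀ {q} → q ∈ S → InCone (f e₁) (f e₂) (f q)) → ConeScan (w ∷ S)
  extendCone {S} w e₁ e₂ e₁∈S e₂∈S 0<X inCone = bySigns (ℤₚ.<-cmp 0ℤ α) (ℤₚ.<-cmp 0ℤ β)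
    where
      α β : ℤ
      α = cross (f e₁) (f w)
      β = cross (f w) (f e₂)
      keep : InCone (f e₁) (f e₂) (f w) → ConeScan (w ∷ S)
      keep w∈cone = cone e₁ e₂ (there e₁∈S) (there e₂∈S) 0<X inCone′
        where
          inCone′ : ∀ {q} → q ∈ w ∷ S → InCone (f e₁) (f e₂) (f q)
          inCone′ (here refl)  = w∈cone
          inCone′ (there q∈S) = inCone q∈S
      opposite : α ≤ 0ℤ → β ≤ 0ℤ → ConeScan (w ∷ S)
      opposite α≤0 β≤0 = vanishing (oppositeToCone w e₁ e₂ e₁∈S e₂∈S 0<X α≤0 β≤0)
      widenˡ : α < 0ℤ → 0ℤ < β → ConeScan (w ∷ S)
      widenˡ α<0 0<β = cone w e₂ (here refl) (there e₂∈S) 0<β inCone′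
        where
          inCone′ : ∀ {q} → q ∈ w ∷ S → InCone (f w) (f e₂) (f q)
          inCone′ (here refl)     = InCone-leftEdge (f w) (f e₂) (f w) (cross-self (f w)) 0<β
          inCone′ {q} (there q∈S) = InCone-widenˡ (f e₁) (f e₂) (f w) (f q) 0<X α<0 0<β (inCone q∈S)
      widenʳ : 0ℤ < α → β < 0ℤ → ConeScan (w ∷ S)
      widenʳ 0<α β<0 = cone e₁ w (there e₁∈S) (here refl) 0<α inCone′
        where
          inCone′ : ∀ {q} → q ∈ w ∷ S → InCone (f e₁) (f w) (f q)
          inCone′ (here refl)     = InCone-rightEdge (f e₁) (f w) (f w) 0<α (cross-self (f w))
          inCone′ {q} (there q∈S) = InCone-widenʳ (f e₁) (f e₂) (f w) (f q) 0<X 0<α β<0 (inCone q∈S)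
      bySigns : Tri (0ℤ < α) (0ℤ ≡ α) (α < 0ℤ) → Tri (0ℤ < β) (0ℤ ≡ β) (β < 0ℤ) → ConeScan (w ∷ S)
      bySigns (tri< 0<α _ _) (tri< 0<β _ _) = keep (ℤₚ.<⇒≤ 0<α , ℤₚ.<⇒≤ 0<β , 0<i+j 0<α (ℤₚ.<⇒≤ 0<β))
      bySigns (tri< 0<α _ _) (tri≈ _ 0≡β _) = keep (InCone-rightEdge (f e₁) (f e₂) (f w) 0<α (sym 0≡β))
      bySigns (tri≈ _ 0≡α _) (tri< 0<β _ _) = keep (InCone-leftEdge (f e₁) (f e₂) (f w) (sym 0≡α) 0<β)
      bySigns (tri≈ _ 0≡α _) (tri≈ _ 0≡β _) =
        opposite (ℤₚ.≤-reflexive (sym 0≡α)) (ℤₚ.≤-reflexive (sym 0≡β))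
      bySigns (tri≈ _ 0≡α _) (tri> _ _ β<0) = opposite (ℤₚ.≤-reflexive (sym 0≡α)) (ℤₚ.<⇒≤ β<0)
      bySigns (tri> _ _ α<0) (tri≈ _ 0≡β _) = opposite (ℤₚ.<⇒≤ α<0) (ℤₚ.≤-reflexive (sym 0≡β))
      bySigns (tri> _ _ α<0) (tri> _ _ β<0) = opposite (ℤₚ.<⇒≤ α<0) (ℤₚ.<⇒≤ β<0)
      bySigns (tri> _ _ α<0) (tri< 0<β _ _) = widenˡ α<0 0<β
      bySigns (tri< 0<α _ _) (tri> _ _ β<0) = widenʳ 0<α β<0

  extend : ∀ {S} w → ConeScan S → ConeScan (w ∷ S)
  extend w none with f w ≟ᴾ (0ℤ , 0ℤ)
  ... | yes fw≡0 = vanishing (zeroVector w fw≡0)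
  ... | no  fw≢0 = ray w (here refl) λ { (here refl) → cross-self (f w) , dot-self-pos (f w) fw≢0 }
  extend w (vanishing z)                      = vanishing (ZeroCombination-∷ w z)
  extend w (ray e e∈S onRay)                  = extendRay w e e∈S onRay
  extend w (cone e₁ e₂ e₁∈S e₂∈S 0<X inCone) = extendCone w e₁ e₂ e₁∈S e₂∈S 0<X inCone

  scan : ∀ S → ConeScan S
  scan []      = none
  scan (w ∷ S) = extend w (scan S)

  conclude : ∀ {S} → ConeScan S → ZeroCombination S ⊎ SeparatingDirection S
  conclude none          = inj₂ ((0ℤ , 0ℤ) , λ ())
  conclude (vanishing z) = inj₁ z
  conclude (ray e _ onRay) = inj₂ ((- proj₁ (f e) , - proj₂ (f e)) , λ {q} q∈S →
    subst (_< 0ℤ) (sym (dot-neg (f e) (f q))) (ℤₚ.neg-mono-< (proj₂ (onRay q∈S))))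
  conclude (cone e₁ e₂ _ _ _ inCone) =
    inj₂ ((proj₂ (f e₁) - proj₂ (f e₂) , proj₁ (f e₂) - proj₁ (f e₁)) , λ {q} q∈S →
      subst (_< 0ℤ) (sym (dot-cone-normal (f e₁) (f e₂) (f q))) (ℤₚ.neg-mono-< (proj₂ (proj₂ (inCone q∈S)))))

  zeroCombination⊎separatingDirection : ∀ S → ZeroCombination S ⊎ SeparatingDirection S
  zeroCombination⊎separatingDirection S = conclude (scan S)

module ListLemmas where
  open import Data.Nat.Base using (suc)
  open import Data.Fin.Base using (Fin; zero; suc; inject₁)
  open import Data.List.Base using (List; []; _∷_; length; lookup; cartesianProduct)
  open import Data.List.Membership.Propositional using (_∈_)
  open import Data.List.Membership.Propositional.Properties using (∈-cartesianProduct⁻; ∈-lookup)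
  open import Data.List.Relation.Unary.All as All using (All; []; _∷_)
  import Data.List.Relation.Unary.All.Properties as Allₚ
  open import Data.List.Relation.Unary.AllPairs as AllPairs using (AllPairs; []; _∷_)
  import Data.List.Relation.Unary.AllPairs.Properties as AllPairsₚ
  open import Data.List.Relation.Unary.Any using (index)
  open import Data.List.Relation.Unary.Any.Properties using (lookup-index)
  open import Data.Product using (∃; _,_; proj₁)
  open import Data.Product.Relation.Binary.Lex.Strict using (×-Lex)
  open import Data.Sum using (inj₁; inj₂)
  open import Function.Bundles using (_⇔_; mk⇔)
  open import Relation.Binary.PropositionalEquality using (_≡_; refl; sym)

  cartesianProduct-Lex : ∀ {A B : Set} {_<₁_ : A → A → Set} {_<₂_ : B → B → Set} {xs ys} →
    AllPairs _<₁_ xs → AllPairs _<₂_ ys → AllPairs (×-Lex _≡_ _<₁_ _<₂_) (cartesianProduct xs ys)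
  cartesianProduct-Lex []                 ys↑ = []
  cartesianProduct-Lex {_<₁_ = _<₁_} {_<₂_} {x ∷ xs} {ys} (x<xs ∷ xs↑) ys↑ =
    AllPairsₚ.++⁺ (AllPairsₚ.map⁺ (AllPairs.map (λ y<y′ → inj₂ (refl , y<y′)) ys↑))
                  (cartesianProduct-Lex xs↑ ys↑)
                  (Allₚ.map⁺ (All.universal (λ y → All.tabulate (later y)) ys))
    where
      later : ∀ y {q} → q ∈ cartesianProduct xs ys → ×-Lex _≡_ _<₁_ _<₂_ (x , y) q
      later y q∈xs×ys = inj₁ (All.lookup x<xs (proj₁ (∈-cartesianProduct⁻ xs ys q∈xs×ys)))

  AllPairs-mapWithAll : ∀ {A : Set} {P : A → Set} {R S : A → A → Set} {xs} →
    (∀ {x y} → P x → P y → R x y → S x y) → All P xs → AllPairs R xs → AllPairs S xs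
  AllPairs-mapWithAll f []         []         = []
  AllPairs-mapWithAll f (px ∷ pxs) (rx ∷ rxs) =
    All.zipWith (λ (py , r) → f px py r) (pxs , rx) ∷ AllPairs-mapWithAll f pxs rxs

  AllPairs-consecutive : ∀ {A : Set} {R : A → A → Set} {x xs} → AllPairs R (x ∷ xs) →
    (i : Fin (length xs)) → R (lookup (x ∷ xs) (inject₁ i)) (lookup (x ∷ xs) (suc i))
  AllPairs-consecutive {xs = y ∷ ys} ((r ∷ _) ∷ _)  zero    = r
  AllPairs-consecutive {xs = y ∷ ys} (_ ∷ ry∷ys)    (suc i) = AllPairs-consecutive ry∷ys i

  ∈⇔∃lookup : ∀ {A : Set} (xs : List A) x → x ∈ xs ⇔ (∃ λ i → lookup xs i ≡ x)
  ∈⇔∃lookup xs x = mk⇔ (λ x∈xs → index x∈xs , sym (lookup-index x∈xs)) (λ { (i , refl) → ∈-lookup i })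


module ModularHyperbola where
  open import Data.Nat.Base as ℕ using (ℕ; zero; suc; z≤n; s≤s; _∸_)
  import Data.Nat.Properties as ℕₚ
  import Data.Nat.Divisibility as ℕ∣
  open import Data.Integer.Base using (ℤ; +_; +[1+_]; 0ℤ; _+_; _-_; _*_; _≤_; _<_; +≤+; +<+; ∣_∣)
  import Data.Integer.Properties as ℤₚ
  import Data.Integer.Divisibility.Signed as ℤ∣
  open import Data.Integer.Tactic.RingSolver using (solve-∀)
  open import Data.List.Base using (List; applyUpTo; cartesianProduct; filter)
  open import Data.List.Membership.Propositional using (_∈_)
  open import Data.List.Membership.Propositional.Properties
    using (∈-applyUpTo⁺; ∈-cartesianProduct⁺; ∈-filter⁺; ∈-filter⁻)
  open import Data.List.Relation.Unary.AllPairs using (AllPairs)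
  import Data.List.Relation.Unary.AllPairs.Properties as AllPairsₚ
  open import Data.Product using (_×_; _,_; proj₁; proj₂)
  open import Data.Product.Relation.Binary.Lex.Strict using (×-Lex)
  open import Data.Sum using (inj₁; inj₂)
  open import Data.Empty using (⊥-elim)
  open import Relation.Binary.PropositionalEquality
  open import Relation.Nullary using (Dec; yes; no; ¬_)
  open import Relation.Nullary.Decidable using (_×-dec_; ¬?)
  open IntegerInequalities
  open Plane using (dot; _≟ᴾ_)
  open ConvexCombination
  open ListLemmas using (cartesianProduct-Lex)
  open ConicAlternative using (ZeroCombination; SeparatingDirection; zeroCombination⊎separatingDirection)

  +k≤n-1⇒k<n : ∀ {n k} → + k ≤ + n - + 1 → k ℕ.< n
  +k≤n-1⇒k<n {suc n} (+≤+ k≤n) = s≤s k≤n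

  InG-one : ∀ n → 2 ℕ.≤ n → InG n (+ 1 , + 1)
  InG-one n@(suc (suc _)) (s≤s (s≤s z≤n)) =
    +≤+ (s≤s z≤n) , +≤+ (s≤s z≤n) , +≤+ (s≤s z≤n) , +≤+ (s≤s z≤n) , ℕ∣._∣0 n

  InG-top : ∀ n → 2 ℕ.≤ n → InG n (+ n - + 1 , + n - + 1)
  InG-top n@(suc (suc _)) (s≤s (s≤s z≤n)) =
    +≤+ (s≤s z≤n) , ℤₚ.≤-refl , +≤+ (s≤s z≤n) , ℤₚ.≤-refl ,
    ℤ∣.∣⇒∣ᵤ (subst (+ n ℤ∣.∣_) (identity (+ n)) (ℤ∣.∣m⇒∣m*n (+ n - + 2) ℤ∣.∣-refl))
    where
      identity : ∀ N → N * (N - + 2) ≡ (N - + 1) * (N - + 1) - + 1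
      identity = solve-∀

  InG-reflect : ∀ n a b → InG n (a , b) → InG n (+ n - b , + n - a)
  InG-reflect n a b (1≤a , a≤n-1 , 1≤b , b≤n-1 , n∣ab-1) =
    1≤n-c b≤n-1 , n-c≤n-1 1≤b , 1≤n-c a≤n-1 , n-c≤n-1 1≤a ,
    ℤ∣.∣⇒∣ᵤ (subst (+ n ℤ∣.∣_) (identity (+ n) a b)
      (ℤ∣.∣m∣n⇒∣m+n (ℤ∣.∣m⇒∣m*n (+ n - a - b) ℤ∣.∣-refl) (ℤ∣.∣ᵤ⇒∣ n∣ab-1)))
    where
      1≤n-c : ∀ {c} → c ≤ + n - + 1 → + 1 ≤ + n - c
      1≤n-c {c} c≤n-1 = ℤₚ.0≤i-j⇒j≤i (subst (0ℤ ≤_) (shift (+ n) c) (ℤₚ.i≤j⇒0≤j-i c≤n-1))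
        where
          shift : ∀ N c → N - + 1 - c ≡ N - c - + 1
          shift = solve-∀
      n-c≤n-1 : ∀ {c} → + 1 ≤ c → + n - c ≤ + n - + 1
      n-c≤n-1 {c} 1≤c = ℤₚ.0≤i-j⇒j≤i (subst (0ℤ ≤_) (shift (+ n) c) (ℤₚ.i≤j⇒0≤j-i 1≤c))
        where
          shift : ∀ N c → c - + 1 ≡ N - + 1 - (N - c)
          shift = solve-∀
      identity : ∀ N a b → N * (N - a - b) + (a * b - + 1) ≡ (N - b) * (N - a) - + 1
      identity = solve-∀

  InG-inverse-unique : ∀ n a b b′ → InG n (a , b) → InG n (a , b′) → b ≡ b′
  InG-inverse-unique n a b b′ (_ , _ , 1≤b , b≤n-1 , n∣ab-1) (_ , _ , 1≤b′ , b′≤n-1 , n∣ab′-1) =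
    sym (ℤₚ.i-j≡0⇒i≡j b′ b
      (ℤₚ.∣i∣≡0⇒i≡0 (small-multiple (ℤ∣.∣⇒∣ᵤ n∣b′-b) (distance 1≤b′ b′≤n-1 1≤b b≤n-1))))
    where
      identity : ∀ a b b′ → b * (a * b′ - + 1) - b′ * (a * b - + 1) ≡ b′ - b
      identity = solve-∀
      n∣b′-b : + n ℤ∣.∣ b′ - b
      n∣b′-b = subst (+ n ℤ∣.∣_) (identity a b b′)
        (ℤ∣.∣m∣n⇒∣m-n (ℤ∣.∣n⇒∣m*n b (ℤ∣.∣ᵤ⇒∣ n∣ab′-1)) (ℤ∣.∣n⇒∣m*n b′ (ℤ∣.∣ᵤ⇒∣ n∣ab-1)))
      small-multiple : ∀ {m} → n ℕ∣.∣ m → m ℕ.< n → m ≡ 0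
      small-multiple {zero}  _   _   = refl
      small-multiple {suc m} n∣m m<n = ⊥-elim (ℕ∣.>⇒∤ m<n n∣m)
      distance : ∀ {x y} → + 1 ≤ x → x ≤ + n - + 1 → + 1 ≤ y → y ≤ + n - + 1 → ∣ x - y ∣ ℕ.< n
      distance {+[1+ x ]} {+[1+ y ]} (+≤+ (s≤s _)) x≤n-1 (+≤+ (s≤s _)) y≤n-1 =
        subst (ℕ._< n) (cong ∣_∣ (sym (ℤₚ.[+m]-[+n]≡m⊖n (suc x) (suc y))))
          (ℕₚ.≤-<-trans (ℤₚ.∣m⊝n∣≤m⊔n (suc x) (suc y))
                        (ℕₚ.⊔-lub (+k≤n-1⇒k<n x≤n-1) (+k≤n-1⇒k<n y≤n-1)))

  coordinates : ℕ → List ℤ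
  coordinates n = applyUpTo (λ i → + suc i) (n ∸ 1)

  grid : ℕ → List Point
  grid n = cartesianProduct (coordinates n) (coordinates n)

  InG⇒∈grid : ∀ n p → InG n p → p ∈ grid n
  InG⇒∈grid n (+[1+ x ] , +[1+ y ]) (+≤+ (s≤s _) , x≤n-1 , +≤+ (s≤s _) , y≤n-1 , _) =
    ∈-cartesianProduct⁺ (∈-applyUpTo⁺ (λ i → + suc i) (k<n∸1 {n} x≤n-1))
                        (∈-applyUpTo⁺ (λ i → + suc i) (k<n∸1 {n} y≤n-1))
    where
      k<n∸1 : ∀ {m k} → + suc k ≤ + m - + 1 → k ℕ.< m ∸ 1
      k<n∸1 {suc m} (+≤+ k<m) = k<m

  grid-Lex : ∀ n → AllPairs (×-Lex _≡_ _<_ _<_) (grid n)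
  grid-Lex n = cartesianProduct-Lex increasing increasing
    where
      increasing : AllPairs _<_ (coordinates n)
      increasing = AllPairsₚ.applyUpTo⁺₁ (λ i → + suc i) (n ∸ 1) (λ i<j _ → +<+ (s≤s i<j))

  InG? : ∀ n p → Dec (InG n p)
  InG? n (x , y) =
    (+ 1 ℤₚ.≤? x) ×-dec (x ℤₚ.≤? + n - + 1) ×-dec (+ 1 ℤₚ.≤? y) ×-dec (y ℤₚ.≤? + n - + 1) ×-dec
    (n ℕ∣.∣? ∣ x * y - + 1 ∣)

  InT? : ∀ n p → Dec (InT n p)
  InT? n (x , y) = (0ℤ ℤₚ.≤? x) ×-dec (x ℤₚ.≤? y) ×-dec (x + y ℤₚ.≤? + n)

  relativeTo : Point → Point → Point
  relativeTo p q = (proj₁ q - proj₁ p , proj₂ q - proj₂ p)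

  G : ℕ → List Point
  G n = filter (InG? n) (grid n)

  others : ℕ → Point → List Point
  others n p = filter (λ q → ¬? (q ≟ᴾ p)) (G n)

  ∈-others⁻ : ∀ {n p q} → q ∈ others n p → InG n q × q ≢ p
  ∈-others⁻ {n} {p} q∈others with ∈-filter⁻ (λ q → ¬? (q ≟ᴾ p)) {xs = G n} q∈others
  ... | q∈G , q≢p = proj₂ (∈-filter⁻ (InG? n) {xs = grid n} q∈G) , q≢p

  ∈-others⁺ : ∀ {n p q} → InG n q → q ≢ p → q ∈ others n p
  ∈-others⁺ {n} {p} {q} q∈G q≢p =
    ∈-filter⁺ (λ q → ¬? (q ≟ᴾ p)) (∈-filter⁺ (InG? n) (InG⇒∈grid n q q∈G) q∈G) q≢p

  zeroCombination⇒InHullOfOthers : ∀ n p → ZeroCombination (relativeTo p) (others n p) → InHullOfOthers n p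
  zeroCombination⇒InHullOfOthers n p z = integerCombination⇒InHullOfOthers n p size coeff vector
    (λ i → ∈-others⁻ (vector∈S i)) coeff≥0 Σcoeff>0
    (balanced (λ i → proj₁ (vector i)) (proj₁ p) Σˣ≡0) (balanced (λ i → proj₂ (vector i)) (proj₂ p) Σʸ≡0)
    where
      open ZeroCombination z
      balanced : ∀ x px → sumℤ size (λ i → coeff i * (x i - px)) ≡ 0ℤ →
                 sumℤ size (λ i → coeff i * x i) ≡ sumℤ size coeff * px
      balanced x px Σ≡0 = ℤₚ.i-j≡0⇒i≡j _ _ (trans (sym (sumℤ-*-shift size coeff x px)) Σ≡0)

  separatingDirection⇒¬InHullOfOthers : ∀ n p → SeparatingDirection (relativeTo p) (others n p) →
                                        ¬ InHullOfOthers n p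
  separatingDirection⇒¬InHullOfOthers n p (c , below) = separated⇒¬InHullOfOthers n p c λ q q∈G q≢p →
    i-j<0⇒i<j (subst (_< 0ℤ) (dot-relative c p q) (below (∈-others⁺ q∈G q≢p)))
    where
      dot-relative : ∀ c p q → dot c (relativeTo p q) ≡ dot c q - dot c p
      dot-relative (c₁ , c₂) (a , b) (x , y) = identity c₁ c₂ a b x y
        where
          identity : ∀ c₁ c₂ a b x y → c₁ * (x - a) + c₂ * (y - b) ≡ (c₁ * x + c₂ * y) - (c₁ * a + c₂ * b)
          identity = solve-∀

  IsVertex? : ∀ n p → Dec (IsVertex n p)
  IsVertex? n p with InG? n p | zeroCombination⊎separatingDirection (relativeTo p) (others n p)
  ... | no p∉G | _      = no (λ v → p∉G (proj₁ v))
  ... | yes _  | inj₁ z = no (λ v → proj₂ v (zeroCombination⇒InHullOfOthers n p z))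
  ... | yes p∈G | inj₂ s = yes (p∈G , separatingDirection⇒¬InHullOfOthers n p s)

module VerticesInTriangle where
  open import Data.Nat.Base as ℕ using (ℕ; zero; suc; z≤n; s≤s)
  open import Data.Integer.Base using (ℤ; +_; 0ℤ; 1ℤ; -1ℤ; _+_; _-_; _*_; -_; _≤_; _<_; +≤+)
  import Data.Integer.Properties as ℤₚ
  open import Data.Integer.Tactic.RingSolver using (solve-∀)
  open import Data.Fin.Base using (Fin; zero; suc)
  open import Data.List.Base using (List; _∷_; filter)
  open import Data.List.Properties using (filter-accept)
  open import Data.List.Membership.Propositional using (_∈_)
  open import Data.List.Membership.Propositional.Properties using (∈-filter⁺; ∈-filter⁻)
  import Data.List.Relation.Unary.All as All
  open import Data.List.Relation.Unary.AllPairs using (AllPairs)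
  import Data.List.Relation.Unary.AllPairs.Properties as AllPairsₚ
  open import Data.Product using (Σ; _×_; _,_; proj₁; proj₂)
  open import Data.Product.Relation.Binary.Lex.Strict using (×-Lex)
  open import Data.Sum using (inj₁; inj₂)
  open import Data.Empty using (⊥-elim)
  open import Function.Bundles using (_⇔_; mk⇔; Equivalence)
  open import Relation.Binary.PropositionalEquality
  open import Relation.Nullary using (Dec; ¬_; yes; no)
  open import Relation.Nullary.Decidable using (_×-dec_)
  open IntegerInequalities
  open Plane using (dot)
  open ConvexCombination
  open ListLemmas using (AllPairs-mapWithAll)
  open ModularHyperbola

  x<⇒≢ : ∀ {p q : Point} → proj₁ p < proj₁ q → p ≢ q
  x<⇒≢ x<x refl = ℤₚ.<-irrefl refl x<x

  y<⇒≢ : ∀ {p q : Point} → proj₂ p < proj₂ q → p ≢ q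
  y<⇒≢ y<y refl = ℤₚ.<-irrefl refl y<y

  one-IsVertex : ∀ n → 2 ℕ.≤ n → IsVertex n (+ 1 , + 1)
  one-IsVertex n 2≤n = InG-one n 2≤n , separated⇒¬InHullOfOthers n (+ 1 , + 1) (-1ℤ , -1ℤ) below
    where
      identity : ∀ x y → x - + 1 - 1ℤ + (y - + 1) ≡ (- + 1 * + 1 + - + 1 * + 1) - (- + 1 * x + - + 1 * y) - 1ℤ
      identity = solve-∀
      identity′ : ∀ y → y - + 1 - 1ℤ ≡ (- + 1 * + 1 + - + 1 * + 1) - (- + 1 * + 1 + - + 1 * y) - 1ℤ
      identity′ = solve-∀
      below : ∀ q → InG n q → q ≢ (+ 1 , + 1) → dot (-1ℤ , -1ℤ) q < dot (-1ℤ , -1ℤ) (+ 1 , + 1)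
      below (x , y) (1≤x , _ , 1≤y , _ , _) q≢1 with x ℤₚ.≟ + 1
      ... | no x≢1 = 0≤j-i-1⇒i<j (subst (0ℤ ≤_) (identity x y)
        (0≤i+j (i<j⇒0≤j-i-1 (ℤₚ.≤∧≢⇒< 1≤x (≢-sym x≢1))) (ℤₚ.i≤j⇒0≤j-i 1≤y)))
      ... | yes refl = 0≤j-i-1⇒i<j (subst (0ℤ ≤_) (identity′ y)
        (i<j⇒0≤j-i-1 (ℤₚ.≤∧≢⇒< 1≤y (λ 1≡y → q≢1 (cong (+ 1 ,_) (sym 1≡y))))))

  -- (a, a) is a proper convex combination of (1, 1) and (n - 1, n - 1).
  diagonal-¬IsVertex : ∀ n a → 2 ℕ.≤ n → InT n (a , a) → + 1 < a → ¬ IsVertex n (a , a)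
  diagonal-¬IsVertex n a 2≤n (_ , _ , a+a≤n) 1<a (_ , ¬hull) = ¬hull
    (integerCombination⇒InHullOfOthers n (a , a) 2 weight point point∈others weight≥0
      (0<i+j 0<w₀ (0≤i+j (ℤₚ.<⇒≤ 0<w₁) ℤₚ.≤-refl)) (identity (+ n) a) (identity (+ n) a))
    where
      weight : Fin 2 → ℤ
      weight zero       = + n - + 1 - a
      weight (suc zero) = a - + 1
      point : Fin 2 → Point
      point zero       = (+ 1 , + 1)
      point (suc zero) = (+ n - + 1 , + n - + 1)
      a<n-1 : a < + n - + 1
      a<n-1 = 0≤j-i-1⇒i<j (subst (0ℤ ≤_) (shift (+ n) a)
        (0≤i+j (ℤₚ.i≤j⇒0≤j-i a+a≤n) (i<j⇒0≤j-i-1 1<a)))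
        where
          shift : ∀ N a → N - (a + a) + (a - + 1 - 1ℤ) ≡ N - + 1 - a - 1ℤ
          shift = solve-∀
      0<w₀ : 0ℤ < weight zero
      0<w₀ = i<j⇒0<j-i a<n-1
      0<w₁ : 0ℤ < weight (suc zero)
      0<w₁ = i<j⇒0<j-i 1<a
      weight≥0 : ∀ i → 0ℤ ≤ weight i
      weight≥0 zero       = ℤₚ.<⇒≤ 0<w₀
      weight≥0 (suc zero) = ℤₚ.<⇒≤ 0<w₁
      point∈others : ∀ i → InG n (point i) × point i ≢ (a , a)
      point∈others zero       = InG-one n 2≤n , x<⇒≢ 1<a
      point∈others (suc zero) = InG-top n 2≤n , ≢-sym (x<⇒≢ a<n-1)
      identity : ∀ N a → (N - + 1 - a) * + 1 + ((a - + 1) * (N - + 1) + 0ℤ) ≡ ((N - + 1 - a) + ((a - + 1) + 0ℤ)) * a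
      identity = solve-∀

  -- With d = b - a, e = b′ - a′ and t = m / D, the point (a′, b′) divides in ratio e : d - e the segment
  -- from the point at parameter t on [(1, 1), (n - 1, n - 1)] to the point at parameter t on [P, Q],
  -- where P = (a, b) and Q = (n - b, n - a) is its reflection.
  module Trapezoid (n : ℕ) (a b a′ b′ : ℤ) where
    N d e m D : ℤ
    N = + n
    d = b - a
    e = b′ - a′
    m = d * (a′ - + 1) - e * (a - + 1)
    D = (d - e) * (N - + 2) + e * (N - a - b)

    weight : Fin 4 → ℤ
    weight zero                   = (d - e) * (D - m)
    weight (suc zero)             = (d - e) * m
    weight (suc (suc zero))       = e * (D - m)
    weight (suc (suc (suc zero))) = e * m

    point : Fin 4 → Point
    point zero                   = (+ 1 , + 1)
    point (suc zero)             = (N - + 1 , N - + 1)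
    point (suc (suc zero))       = (a , b)
    point (suc (suc (suc zero))) = (N - b , N - a)

    combinationˣ : sumℤ 4 (λ i → weight i * proj₁ (point i)) ≡ sumℤ 4 weight * a′
    combinationˣ = identity a b a′ b′ N
      where
        identity : ∀ a b a′ b′ N →
          let d = b - a
              e = b′ - a′
              m = d * (a′ - + 1) - e * (a - + 1)
              D = (d - e) * (N - + 2) + e * (N - a - b)
          in
          (d - e) * (D - m) * + 1 + ((d - e) * m * (N - + 1) + (e * (D - m) * a + (e * m * (N - b) + 0ℤ))) ≡
          ((d - e) * (D - m) + ((d - e) * m + (e * (D - m) + (e * m + 0ℤ)))) * a′
        identity = solve-∀

    combinationʸ : sumℤ 4 (λ i → weight i * proj₂ (point i)) ≡ sumℤ 4 weight * b′
    combinationʸ = identity a b a′ b′ N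
      where
        identity : ∀ a b a′ b′ N →
          let d = b - a
              e = b′ - a′
              m = d * (a′ - + 1) - e * (a - + 1)
              D = (d - e) * (N - + 2) + e * (N - a - b)
          in
          (d - e) * (D - m) * + 1 + ((d - e) * m * (N - + 1) + (e * (D - m) * b + (e * m * (N - a) + 0ℤ))) ≡
          ((d - e) * (D - m) + ((d - e) * m + (e * (D - m) + (e * m + 0ℤ)))) * b′
        identity = solve-∀

    weight-sign : + 1 ≤ a → 0ℤ ≤ N - (a′ + b′) → a < a′ → a′ < b′ → e ≤ d →
                  (∀ i → 0ℤ ≤ weight i) × 0ℤ < weight (suc (suc (suc zero)))
    weight-sign 1≤a 0≤n-a′-b′ a<a′ a′<b′ e≤d = weight≥0 , 0<i*j 0<e 0<m
      where
        0≤d-e : 0ℤ ≤ d - e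
        0≤d-e = ℤₚ.i≤j⇒0≤j-i e≤d
        0<e : 0ℤ < e
        0<e = i<j⇒0<j-i a′<b′
        0<d : 0ℤ < d
        0<d = subst (0ℤ <_) (trans (ℤₚ.+-comm e (d - e)) (cancel b a b′ a′)) (0<i+j 0<e 0≤d-e)
          where
            cancel : ∀ b a b′ a′ → (b - a) - (b′ - a′) + (b′ - a′) ≡ b - a
            cancel = solve-∀
        0<m : 0ℤ < m
        0<m = subst (0ℤ <_) (expand a b a′ b′)
          (0<i+j (0<i*j 0<d (i<j⇒0<j-i a<a′)) (0≤i*j 0≤d-e (ℤₚ.i≤j⇒0≤j-i 1≤a)))
          where
            expand : ∀ a b a′ b′ → (b - a) * (a′ - a) + ((b - a) - (b′ - a′)) * (a - + 1) ≡
                                   (b - a) * (a′ - + 1) - (b′ - a′) * (a - + 1)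
            expand = solve-∀
        0≤D-m : 0ℤ ≤ D - m
        0≤D-m = subst (0ℤ ≤_) (expand a b a′ b′ N)
          (0≤i+j (0≤i*j (ℤₚ.<⇒≤ 0<d) 0≤n-a′-b′) (ℤₚ.<⇒≤ 0<m))
          where
            expand : ∀ a b a′ b′ N →
              (b - a) * (N - (a′ + b′)) + ((b - a) * (a′ - + 1) - (b′ - a′) * (a - + 1)) ≡
              ((b - a) - (b′ - a′)) * (N - + 2) + (b′ - a′) * (N - a - b)
                - ((b - a) * (a′ - + 1) - (b′ - a′) * (a - + 1))
            expand = solve-∀
        weight≥0 : ∀ i → 0ℤ ≤ weight i
        weight≥0 zero                   = 0≤i*j 0≤d-e 0≤D-m
        weight≥0 (suc zero)             = 0≤i*j 0≤d-e (ℤₚ.<⇒≤ 0<m)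
        weight≥0 (suc (suc zero))       = 0≤i*j (ℤₚ.<⇒≤ 0<e) 0≤D-m
        weight≥0 (suc (suc (suc zero))) = ℤₚ.<⇒≤ (0<i*j 0<e 0<m)

    point∈others : 2 ℕ.≤ n → InG n (a , b) → 0ℤ ≤ N - (a′ + b′) → a < a′ → a′ < b′ →
                   ∀ i → InG n (point i) × point i ≢ (a′ , b′)
    point∈others 2≤n P∈G 0≤n-a′-b′ a<a′ a′<b′ = λ where
        zero                   → InG-one n 2≤n , x<⇒≢ (ℤₚ.≤-<-trans (proj₁ P∈G) a<a′)
        (suc zero)             → InG-top n 2≤n , ≢-sym (x<⇒≢ a′<n-1)
        (suc (suc zero))       → P∈G , x<⇒≢ a<a′
        (suc (suc (suc zero))) → InG-reflect n a b P∈G , ≢-sym (y<⇒≢ b′<n-a)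
      where
        a′<n-1 : a′ < N - + 1
        a′<n-1 = 0≤j-i-1⇒i<j (subst (0ℤ ≤_) (expand a a′ b′ N)
          (0≤i+j (0≤i+j (0≤i+j (0≤i+j 0≤n-a′-b′ (i<j⇒0≤j-i-1 a′<b′)) (i<j⇒0≤j-i-1 a<a′))
                        (ℤₚ.i≤j⇒0≤j-i (proj₁ P∈G)))
                 (+≤+ z≤n)))
          where
            expand : ∀ a a′ b′ N →
              N - (a′ + b′) + (b′ - a′ - 1ℤ) + (a′ - a - 1ℤ) + (a - + 1) + + 1 ≡ N - + 1 - a′ - 1ℤ
            expand = solve-∀
        b′<n-a : b′ < N - a
        b′<n-a = 0≤j-i-1⇒i<j (subst (0ℤ ≤_) (expand a a′ b′ N) (0≤i+j (i<j⇒0≤j-i-1 a<a′) 0≤n-a′-b′))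
          where
            expand : ∀ a a′ b′ N → a′ - a - 1ℤ + (N - (a′ + b′)) ≡ N - a - b′ - 1ℤ
            expand = solve-∀

  trapezoid-¬IsVertex : ∀ n a b a′ b′ → 2 ℕ.≤ n → InG n (a , b) → InT n (a′ , b′) →
                        a < a′ → a′ < b′ → b′ - a′ ≤ b - a → ¬ IsVertex n (a′ , b′)
  trapezoid-¬IsVertex n a b a′ b′ 2≤n P∈G (_ , _ , a′+b′≤n) a<a′ a′<b′ e≤d (_ , ¬hull) =
    ¬hull (integerCombination⇒InHullOfOthers n (a′ , b′) 4 weight point
      (point∈others 2≤n P∈G 0≤n-a′-b′ a<a′ a′<b′) weight≥0
      (ℤₚ.+-mono-≤-< (weight≥0 zero) (ℤₚ.+-mono-≤-< (weight≥0 (suc zero))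
        (ℤₚ.+-mono-≤-< (weight≥0 (suc (suc zero))) (0<i+j 0<weight₃ ℤₚ.≤-refl))))
      combinationˣ combinationʸ)
    where
      open Trapezoid n a b a′ b′
      0≤n-a′-b′ : 0ℤ ≤ N - (a′ + b′)
      0≤n-a′-b′ = ℤₚ.i≤j⇒0≤j-i a′+b′≤n
      weight≥0 : ∀ i → 0ℤ ≤ weight i
      weight≥0 = proj₁ (weight-sign (proj₁ P∈G) 0≤n-a′-b′ a<a′ a′<b′ e≤d)
      0<weight₃ : 0ℤ < weight (suc (suc (suc zero)))
      0<weight₃ = proj₂ (weight-sign (proj₁ P∈G) 0≤n-a′-b′ a<a′ a′<b′ e≤d)

  VertexInT : ℕ → Point → Set
  VertexInT n p = IsVertex n p × InT n p

  _<ˣ_ : Point → Point → Set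
  p <ˣ q = proj₁ p < proj₁ q

  gap : Point → ℤ
  gap (a , b) = b - a

  vertex-above-diagonal : ∀ n a b → 2 ℕ.≤ n → VertexInT n (a , b) → + 1 < a → a < b
  vertex-above-diagonal n a b 2≤n (V , T@(_ , a≤b , _)) 1<a with a ℤₚ.≟ b
  ... | no a≢b    = ℤₚ.≤∧≢⇒< a≤b a≢b
  ... | yes refl  = ⊥-elim (diagonal-¬IsVertex n a 2≤n T 1<a V)

  gap-increasing : ∀ n p q → 2 ℕ.≤ n → InG n p → VertexInT n q → p <ˣ q → proj₁ q < proj₂ q →
                   gap p < gap q
  gap-increasing n (a , b) (a′ , b′) 2≤n P∈G (Q-vertex , Q∈T) a<a′ a′<b′
    with gap (a , b) ℤₚ.<? gap (a′ , b′)
  ... | yes gap< = gap<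
  ... | no  gap≮ =
    ⊥-elim (trapezoid-¬IsVertex n a b a′ b′ 2≤n P∈G Q∈T a<a′ a′<b′ (ℤₚ.≮⇒≥ gap≮) Q-vertex)

  <ˣ∧gap<⇒<ʸ : ∀ p q → p <ˣ q → gap p < gap q → proj₂ p < proj₂ q
  <ˣ∧gap<⇒<ʸ (a , b) (a′ , b′) a<a′ gap< = 0≤j-i-1⇒i<j (subst (0ℤ ≤_) (identity a b a′ b′)
    (0≤i+j (0≤i+j (i<j⇒0≤j-i-1 a<a′) (i<j⇒0≤j-i-1 gap<)) (+≤+ z≤n)))
    where
      identity : ∀ a b a′ b′ → a′ - a - 1ℤ + (b′ - a′ - (b - a) - 1ℤ) + + 1 ≡ b′ - b - 1ℤ
      identity = solve-∀

  VertexInT? : ∀ n p → Dec (VertexInT n p)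
  VertexInT? n p = IsVertex? n p ×-dec InT? n p

  vertices : ℕ → List Point
  vertices n = filter (VertexInT? n) (grid n)

  ∈-vertices : ∀ n p → VertexInT n p ⇔ p ∈ vertices n
  ∈-vertices n p = mk⇔
    (λ p∈VT → ∈-filter⁺ (VertexInT? n) (InG⇒∈grid n p (proj₁ (proj₁ p∈VT))) p∈VT)
    (λ p∈vs → proj₂ (∈-filter⁻ (VertexInT? n) {xs = grid n} p∈vs))

  vertices-<ˣ : ∀ n → AllPairs _<ˣ_ (vertices n)
  vertices-<ˣ n = AllPairs-mapWithAll lex⇒<ˣ
    (All.tabulate (λ {p} p∈vs → proj₁ (proj₁ (Equivalence.from (∈-vertices n p) p∈vs))))
    (AllPairsₚ.filter⁺ (VertexInT? n) (grid-Lex n))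
    where
      lex⇒<ˣ : ∀ {p q} → InG n p → InG n q → ×-Lex _≡_ _<_ _<_ p q → p <ˣ q
      lex⇒<ˣ _ _ (inj₁ a<a′) = a<a′
      lex⇒<ˣ {a , b} {_ , b′} p∈G q∈G (inj₂ (refl , b<b′)) =
        ⊥-elim (ℤₚ.<-irrefl (InG-inverse-unique n a b b′ p∈G q∈G) b<b′)

  vertices-head : ∀ n → 2 ℕ.≤ n → Σ (List Point) λ vs → vertices n ≡ (+ 1 , + 1) ∷ vs
  vertices-head n@(suc (suc _)) 2≤n@(s≤s (s≤s z≤n)) =
    _ , filter-accept (VertexInT? n) (one-IsVertex n 2≤n , +≤+ z≤n , ℤₚ.≤-refl , +≤+ 2≤n)

  sorted-vertices : ∀ n → 2 ℕ.≤ n → Σ (List Point) λ vs →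
    (∀ p → VertexInT n p ⇔ p ∈ (+ 1 , + 1) ∷ vs) × AllPairs _<ˣ_ ((+ 1 , + 1) ∷ vs)
  sorted-vertices n 2≤n with vertices-head n 2≤n
  ... | vs , vertices≡ = vs , subst (λ xs → ∀ p → VertexInT n p ⇔ p ∈ xs) vertices≡ (∈-vertices n) ,
                             subst (AllPairs _<ˣ_) vertices≡ (vertices-<ˣ n)

open import Data.Nat using (ℕ; _≤_)
open import Data.Integer as ℤ using (+_)
open import Data.Fin using (Fin; zero; suc; inject₁)
open import Data.Product using (_×_; _,_; proj₁; proj₂; Σ; ∃)
open import Relation.Binary.PropositionalEquality using (_≡_; refl)
open import Function.Bundles using (_⇔_; Equivalence)
import Function.Properties.Equivalence as ⇔
open import Data.List.Base using (_∷_; length; lookup)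
open import Data.List.Membership.Propositional.Properties using (∈-lookup)
import Data.List.Relation.Unary.All as All
open import Data.List.Relation.Unary.AllPairs as AllPairs using (AllPairs)
open VerticesInTriangle
open ListLemmas using (∈⇔∃lookup; AllPairs-consecutive)

proposition3 : (n : ℕ) → 2 ≤ n →
    Σ ℕ λ s → Σ (Fin (ℕ.suc s) → Point) λ v →
      (∀ p → (IsVertex n p × InT n p) ⇔ (∃ λ i → v i ≡ p)) ×
      (∀ (i : Fin s) → proj₁ (v (inject₁ i)) ℤ.< proj₁ (v (suc i))) ×
      (v zero ≡ (+ 1 , + 1)) ×
      (∀ (i : Fin s) → proj₁ (v (suc i)) ℤ.< proj₂ (v (suc i))) ×
      (∀ (i : Fin s) → proj₂ (v (inject₁ i)) ℤ.< proj₂ (v (suc i))) ×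
      (∀ (i : Fin s) → proj₂ (v (inject₁ i)) ℤ.- proj₁ (v (inject₁ i))
                         ℤ.< proj₂ (v (suc i)) ℤ.- proj₁ (v (suc i)))
proposition3 n 2≤n with sorted-vertices n 2≤n
... | vs , vertex⇔∈ , sorted =
  length vs , v , membership , x-increasing , refl , above-diagonal , y-increasing , gaps-increasing
  where
    v : Fin (ℕ.suc (length vs)) → Point
    v = lookup ((+ 1 , + 1) ∷ vs)
    membership : ∀ p → VertexInT n p ⇔ (∃ λ i → v i ≡ p)
    membership p = ⇔.trans (vertex⇔∈ p) (∈⇔∃lookup ((+ 1 , + 1) ∷ vs) p)
    vertex : ∀ i → VertexInT n (v i)
    vertex i = Equivalence.from (membership (v i)) (i , refl)
    x-increasing : ∀ i → v (inject₁ i) <ˣ v (suc i)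
    x-increasing = AllPairs-consecutive sorted
    above-diagonal : ∀ i → proj₁ (v (suc i)) ℤ.< proj₂ (v (suc i))
    above-diagonal i =
      vertex-above-diagonal n _ _ 2≤n (vertex (suc i)) (All.lookup (AllPairs.head sorted) (∈-lookup i))
    gaps-increasing : ∀ i → gap (v (inject₁ i)) ℤ.< gap (v (suc i))
    gaps-increasing i = gap-increasing n _ _ 2≤n (proj₁ (proj₁ (vertex (inject₁ i)))) (vertex (suc i))
                                       (x-increasing i) (above-diagonal i)
    y-increasing : ∀ i → proj₂ (v (inject₁ i)) ℤ.< proj₂ (v (suc i))
    y-increasing i = <ˣ∧gap<⇒<ʸ (v (inject₁ i)) (v (suc i)) (x-increasing i) (gaps-increasing i)
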